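{- Let $\phi = \frac{1+\sqrt5}{2}$, $a(k) = \lfloor k\phi\rfloor$ and $d(k) = 3a(k)+k$. Then for every positive integer $k$, \[ \{d(k)\phi\} = 1 - \frac{\sqrt5}{\phi^2}\{k\phi\}. \]
   Context: $\{x\} = x - \lfloor x\rfloor$ denotes the fractional part. -}

module Defs where

-- Exact arithmetic in ℤ[φ] ⊂ ℝ, φ = (1+√5)/2, φ² = φ + 1.
-- An element x + y·φ is represented by mk x y; since φ is
-- irrational, two such reals are equal iff their coordinates are equal,
-- so propositional equality of pairs is equality of real numbers.

open import Data.Integer using (ℤ; +_; _+_; _-_; _*_; -_; _≤_; _<_)
open import Data.Product using (_×_; _,_)
open import Data.Sum using (_⊎_)
open import Relation.Binary.PropositionalEquality using (_≡_; _≢_; refl)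

record ℤφ : Set where
  constructor mk
  field
    re : ℤ
    im : ℤ
open ℤφ public

infixl 6 _⊕_ _⊖_
infixl 7 _⊗_

ι : ℤ → ℤφ
ι n = mk n (+ 0)

φ : ℤφ
φ = mk (+ 0) (+ 1)

_⊕_ : ℤφ → ℤφ → ℤφ
mk a b ⊕ mk c d = mk (a + c) (b + d)

⊖_ : ℤφ → ℤφ
⊖ mk a b = mk (- a) (- b)

_⊖_ : ℤφ → ℤφ → ℤφ
v ⊖ w = v ⊕ (⊖ w)

-- (a + bφ)(c + dφ) = (ac + bd) + (ad + bc + bd)φ   using φ² = φ + 1
_⊗_ : ℤφ → ℤφ → ℤφ
mk a b ⊗ mk c d = mk (a * c + b * d) (a * d + b * c + b * d)

-- √5 = 2φ - 1
√5 : ℤφ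
√5 = mk (- (+ 1)) (+ 2)

φ⁻¹ : ℤφ
φ⁻¹ = mk (- (+ 1)) (+ 1)

φ⊗φ⁻¹≡1 : φ ⊗ φ⁻¹ ≡ ι (+ 1)
φ⊗φ⁻¹≡1 = refl

-- The real order on ℤ[φ]:  x + yφ = (p + q√5)/2 with p = 2x + y, q = y.
-- p + q√5 ≥ 0  iff  one of the three cases below.
NonNeg : ℤφ → Set
NonNeg (mk x y) =
  let p = (+ 2) * x + y
      q = y
  in  ((+ 0) ≤ p × (+ 0) ≤ q)
    ⊎ ((+ 0) ≤ p × q < (+ 0) × (+ 5) * (q * q) ≤ p * p)
    ⊎ (p < (+ 0) × (+ 0) ≤ q × p * p ≤ (+ 5) * (q * q))

_≤φ_ : ℤφ → ℤφ → Set
v ≤φ w = NonNeg (w ⊖ v)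

_<φ_ : ℤφ → ℤφ → Set
v <φ w = v ≤φ w × v ≢ w

IsFloor : ℤφ → ℤ → Set
IsFloor v n = ι n ≤φ v × v <φ ι (n + (+ 1))

-- {v} = v - ⌊v⌋, given n = ⌊v⌋
frac : ℤφ → ℤ → ℤφ
frac v n = v ⊖ ι n

module Submission where

-- Let a = ⌊kφ⌋, x = kφ - a ∈ (0,1), D = 3a + k and c = 4a + 3k - 1.  Using φ² = φ + 1,
--   Dφ - c = 1 - (√5/φ²)·x,        with √5/φ² = 3φ - 4 ∈ (0,1),
-- so Dφ - c lies in (0,1).  Hence ⌊Dφ⌋ = c and the claim is the displayed identity, a
-- coordinate computation in ℤ[φ] (frac-identity).
--
-- The real work is ⌊Dφ⌋ = c.  We make the order of ℤ[φ] concrete through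
--   M x K = K² + xK - x² = (Kφ - x)(x + K/φ),
-- so that for x ≥ 0 the sign of M x K is the sign of Kφ - x.  Thus x = ⌊Kφ⌋ iff
--   x ≥ 0,  M x K > 0  and  M (1 + x) K < 0                                 (IsFloorφ);
-- floor-decode derives this from the hypotheses (strictness needs M x K ≠ 0, i.e. the
-- irrationality of φ, proved by descent), and floor-unique shows it determines x.  The
-- step a = ⌊kφ⌋ ⟹ c = ⌊Dφ⌋ (floor-of-3a+K) rests on the identities
--   M (1 + c) D = -5 · M a k   and   M c D = 5 (a + k - M a k) - 1.
-- Integer inequalities are certified by ring identities writing the quantity in question
-- as a sum of products of quantities already known to be non-negative.

open import Defs
open import Data.Nat as ℕ using (ℕ)
open import Data.Nat.Induction using (<-wellFounded)
open import Induction.WellFounded using (Acc; acc)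
open import Data.Product using (_×_; _,_)
open import Data.Sum using (_⊎_; inj₁; inj₂)
open import Data.Empty using (⊥; ⊥-elim)
open import Function using (_∘_)
open import Relation.Nullary using (yes; no; ¬_)
open import Relation.Binary.Definitions using (tri<; tri≈; tri>)
open import Relation.Binary.PropositionalEquality
  using (_≡_; _≢_; refl; sym; cong; cong₂; subst; module ≡-Reasoning)

module GoldenDescent where
  open import Data.Nat
  open import Data.Nat.Properties
  import Data.Nat.Tactic.RingSolver as ℕ-Ring
  open ≡-Reasoning

  -- Irrationality of φ: a² = ak + k² has no solution in naturals with k ≥ 1.  If a ≤ k
  -- then a² ≤ ak < ak + k²; otherwise (k, a - k) is a solution with smaller first entry.
  golden-descent : ∀ {a k} → Acc _<_ a → 1 ≤ k → a * a ≢ a * k + k * k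
  golden-descent {a} {k} (acc smaller) 1≤k a²≡ak+k² with a ≤? k
  ... | yes a≤k =
    <-irrefl a²≡ak+k² (≤-<-trans (*-monoʳ-≤ a a≤k) (m<m+n (a * k) (*-mono-≤ 1≤k 1≤k)))
  ... | no a≰k  = golden-descent (smaller k<a) (m<n⇒0<n∸m k<a) k²≡kc+c²
    where
    k<a = ≰⇒> a≰k
    c = a ∸ k
    square : ∀ k c → (k + c) * (k + c) ≡ (k * k + k * c) + (k * c + c * c)
    square = ℕ-Ring.solve-∀
    product : ∀ k c → (k + c) * k + k * k ≡ (k * k + k * c) + k * k
    product = ℕ-Ring.solve-∀
    k²≡kc+c² : k * k ≡ k * c + c * c
    k²≡kc+c² = sym (+-cancelˡ-≡ (k * k + k * c) _ _ (begin
      (k * k + k * c) + (k * c + c * c)  ≡⟨ sym (square k c) ⟩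
      (k + c) * (k + c)                  ≡⟨ subst (λ x → x * x ≡ x * k + k * k)
                                                  (sym (m+[n∸m]≡n (<⇒≤ k<a))) a²≡ak+k² ⟩
      (k + c) * k + k * k                ≡⟨ product k c ⟩
      (k * k + k * c) + k * k            ∎))

open GoldenDescent using (golden-descent)

open import Data.Integer
  using (ℤ; +_; -[1+_]; 0ℤ; _+_; _-_; _*_; -_; _≤_; _<_; +≤+; +<+; _≤?_)
open import Data.Integer.Properties
  using ( +-mono-≤; ≤-trans; <⇒≤; <⇒≱; ≰⇒>; ≤∧≢⇒<; <-cmp; <-asym; i≤j⇒0≤j-i; 0≤i-j⇒j≤i
        ; i<j⇒suc[i]≤j; suc[i]≤j⇒i<j; *-cancelˡ-≤-pos; neg-mono-<; +-identityʳ
        ; +-injective; pos-+; pos-* )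
open import Data.Integer.Tactic.RingSolver using (solve-∀)

0≤+ : ∀ n → 0ℤ ≤ + n
0≤+ n = +≤+ ℕ.z≤n

0≤-+ : ∀ {x y} → 0ℤ ≤ x → 0ℤ ≤ y → 0ℤ ≤ x + y
0≤-+ = +-mono-≤

0≤-* : ∀ {x y} → 0ℤ ≤ x → 0ℤ ≤ y → 0ℤ ≤ x * y
0≤-* {+ m} {+ n} _ _ = subst (0ℤ ≤_) (pos-* m n) (0≤+ (m ℕ.* n))

0≤-sq : ∀ x → 0ℤ ≤ x * x
0≤-sq (+ n)    = 0≤-* (0≤+ n) (0≤+ n)
0≤-sq -[1+ n ] = subst (0ℤ ≤_) (sym (square-negate -[1+ n ])) (0≤-sq (+ ℕ.suc n))
  where
  square-negate : ∀ x → x * x ≡ (- x) * (- x)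
  square-negate = solve-∀

0≤-≡ : ∀ {x y} → 0ℤ ≤ x → x ≡ y → 0ℤ ≤ y
0≤-≡ 0≤x refl = 0≤x

0≰neg : ∀ {n} → ¬ 0ℤ ≤ -[1+ n ]
0≰neg ()

gap : ∀ {i j} → i < j → 0ℤ ≤ j - (+ 1 + i)
gap = i≤j⇒0≤j-i ∘ i<j⇒suc[i]≤j

gap⁻¹ : ∀ {i j} → 0ℤ ≤ j - (+ 1 + i) → i < j
gap⁻¹ = suc[i]≤j⇒i<j ∘ 0≤i-j⇒j≤i

-- Cancelling the factor 4 that clears the denominator of φ = (1 + √5)/2.
0≤4*⇒0≤ : ∀ {x} → 0ℤ ≤ + 4 * x → 0ℤ ≤ x
0≤4*⇒0≤ {x} = *-cancelˡ-≤-pos 0ℤ x (+ 4)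

0≤2x+1⇒0≤x : ∀ {x} → 0ℤ ≤ + 2 * x + + 1 → 0ℤ ≤ x
0≤2x+1⇒0≤x {x} 0≤2x+1 with 0ℤ ≤? x
... | yes 0≤x = 0≤x
... | no 0≰x  =
  ⊥-elim (0≰neg (0≤-≡ (0≤-+ 0≤2x+1 (0≤-* (0≤+ 2) (gap (≰⇒> 0≰x)))) (odd-negative x)))
  where
  odd-negative : ∀ x → + 2 * x + + 1 + + 2 * (0ℤ - (+ 1 + x)) ≡ - (+ 1)
  odd-negative = solve-∀

-- M x K = (Kφ - x)(x + K/φ): for x ≥ 0 its sign is the sign of Kφ - x.
-- The ring solver does not unfold definitions, so the identities about M below are stated
-- with M written out; they apply to M by definitional unfolding.
M : ℤ → ℤ → ℤ
M x K = K * K + x * K - x * x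

-- Kφ is never an integer for K > 0, in the form M x K ≠ 0.
M-nonzero : ∀ {x K} → 0ℤ < K → 0ℤ ≤ x → M x K ≢ 0ℤ
M-nonzero {+ A} {+ k} (+<+ 1≤k) _ M≡0 =
  golden-descent (<-wellFounded A) 1≤k (+-injective (begin
    + (A ℕ.* A)                            ≡⟨ pos-* A A ⟩
    + A * + A                              ≡⟨ M-square (+ A) (+ k) ⟩
    + A * + k + + k * + k - M (+ A) (+ k)  ≡⟨ cong (λ m → + A * + k + + k * + k - m) M≡0 ⟩
    + A * + k + + k * + k + 0ℤ             ≡⟨ +-identityʳ _ ⟩
    + A * + k + + k * + k                  ≡⟨ cong₂ _+_ (sym (pos-* A k)) (sym (pos-* k k)) ⟩
    + (A ℕ.* k) + + (k ℕ.* k)              ≡⟨ sym (pos-+ (A ℕ.* k) (k ℕ.* k)) ⟩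
    + (A ℕ.* k ℕ.+ k ℕ.* k)                ∎))
  where
  open ≡-Reasoning
  M-square : ∀ x K → x * x ≡ x * K + K * K - (K * K + x * K - x * x)
  M-square = solve-∀

-- x is the integer part of Kφ: x ≥ 0 and x < Kφ < 1 + x.
record IsFloorφ (K x : ℤ) : Set where
  constructor floorφ
  field
    nonneg : 0ℤ ≤ x
    below  : 0ℤ < M x K
    above  : M (+ 1 + x) K < 0ℤ

-- Once x ≥ 0 lies above Kφ, so does every y ≥ x.  First x ≥ K (for x < K we would have
-- M x K = K² + x(K - x) ≥ 0), then M y K = M x K - (y - x)(y + x - K) ≤ M x K.
M-neg-persists : ∀ {x y K} → 0ℤ ≤ x → x ≤ y → M x K < 0ℤ → M y K < 0ℤ
M-neg-persists {x} {y} {K} 0≤x x≤y Mx<0 with K ≤? x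
... | no K≰x = ⊥-elim (<⇒≱ Mx<0 (0≤-≡ M≥0 (sym (M-at-small x K))))
  where
  M≥0 = 0≤-+ (0≤-sq K) (0≤-* 0≤x (i≤j⇒0≤j-i (<⇒≤ (≰⇒> K≰x))))
  M-at-small : ∀ x K → K * K + x * K - x * x ≡ K * K + x * (K - x)
  M-at-small = solve-∀
... | yes K≤x = gap⁻¹ (0≤-≡ (0≤-+ (gap Mx<0) decrease≥0) (sym (M-difference x y K)))
  where
  decrease≥0 : 0ℤ ≤ (y - x) * (y + (x - K))
  decrease≥0 = 0≤-* (i≤j⇒0≤j-i x≤y) (0≤-+ (≤-trans 0≤x x≤y) (i≤j⇒0≤j-i K≤x))
  M-difference : ∀ x y K → 0ℤ - (+ 1 + (K * K + y * K - y * y))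
    ≡ (0ℤ - (+ 1 + (K * K + x * K - x * x))) + (y - x) * (y + (x - K))
  M-difference = solve-∀

-- No two integer parts b < c: then c ≥ 1 + b would lie above Kφ, yet c < Kφ.
floor-crossing : ∀ {K b c} → IsFloorφ K b → IsFloorφ K c → b < c → ⊥
floor-crossing {K} (floorφ 0≤b _ 1+b-above) (floorφ _ c-below _) b<c =
  <⇒≱ (M-neg-persists {K = K} (0≤-+ (0≤+ 1) 0≤b) (i<j⇒suc[i]≤j b<c) 1+b-above) (<⇒≤ c-below)

floor-unique : ∀ {K b c} → IsFloorφ K b → IsFloorφ K c → b ≡ c
floor-unique {K} {b} {c} fb fc with <-cmp b c
... | tri< b<c _ _ = ⊥-elim (floor-crossing fb fc b<c)
... | tri≈ _ b≡c _ = b≡c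
... | tri> _ _ c<b = ⊥-elim (floor-crossing fc fb c<b)

-- Reading the order of Defs.  Writing x + yφ = (p + y√5)/2 with p = 2x + y, NonNeg (mk x y)
-- says p + y√5 ≥ 0.  For y > 0 this means p ≥ 0 or p² ≤ 5y² ...
NonNeg-im>0 : ∀ {x y} → 0ℤ < y → NonNeg (mk x y) →
  0ℤ ≤ + 2 * x + y ⊎ (+ 2 * x + y) * (+ 2 * x + y) ≤ + 5 * (y * y)
NonNeg-im>0 _   (inj₁ (0≤p , _))               = inj₁ 0≤p
NonNeg-im>0 0<y (inj₂ (inj₁ (_ , y<0 , _)))    = ⊥-elim (<-asym 0<y y<0)
NonNeg-im>0 _   (inj₂ (inj₂ (_ , _ , p²≤5y²))) = inj₂ p²≤5y²

NonNeg-im<0 : ∀ {x y} → y < 0ℤ → NonNeg (mk x y) →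
  0ℤ ≤ + 2 * x + y × + 5 * (y * y) ≤ (+ 2 * x + y) * (+ 2 * x + y)
NonNeg-im<0 y<0 (inj₁ (_ , 0≤y))                 = ⊥-elim (<⇒≱ y<0 0≤y)
NonNeg-im<0 _   (inj₂ (inj₁ (0≤p , _ , 5y²≤p²))) = 0≤p , 5y²≤p²
NonNeg-im<0 y<0 (inj₂ (inj₂ (_ , 0≤y , _)))      = ⊥-elim (<⇒≱ y<0 0≤y)

Kφ-minus : ∀ K a → ι K ⊗ φ ⊖ ι a ≡ mk (- a) K
Kφ-minus K a = cong₂ mk (re-eq K a) (im-eq K)
  where
  re-eq : ∀ K a → K * + 0 + + 0 * + 1 + - a ≡ - a
  re-eq = solve-∀
  im-eq : ∀ K → K * + 1 + + 0 * + 0 + + 0 * + 1 + - (+ 0) ≡ K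
  im-eq = solve-∀

minus-Kφ : ∀ K a → ι (a + + 1) ⊖ ι K ⊗ φ ≡ mk (a + + 1) (- K)
minus-Kφ K a = cong₂ mk (re-eq K a) (im-eq K)
  where
  re-eq : ∀ K a → a + + 1 + - (K * + 0 + + 0 * + 1) ≡ a + + 1
  re-eq = solve-∀
  im-eq : ∀ K → + 0 + - (K * + 1 + + 0 * + 0 + + 0 * + 1) ≡ - K
  im-eq = solve-∀

-- a ≤ Kφ with a ≥ 0 gives M a K ≥ 0: with p = K - 2a, either p ≥ 0 and
-- M a K = K² + ap + a², or p² ≤ 5K², where 5K² - p² = 4 M a K.
below-Kφ : ∀ {a K} → 0ℤ ≤ a → 0ℤ < K → ι a ≤φ (ι K ⊗ φ) → 0ℤ ≤ M a K
below-Kφ {a} {K} 0≤a 0<K a≤Kφ with NonNeg-im>0 {x = - a} 0<K (subst NonNeg (Kφ-minus K a) a≤Kφ)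
... | inj₁ 0≤p = 0≤-≡ (0≤-+ (0≤-+ (0≤-sq K) (0≤-* 0≤a 0≤p)) (0≤-sq a)) (M-via-p a K)
  where
  M-via-p : ∀ a K → K * K + a * (+ 2 * (- a) + K) + a * a ≡ K * K + a * K - a * a
  M-via-p = solve-∀
... | inj₂ p²≤5K² = 0≤4*⇒0≤ (0≤-≡ (i≤j⇒0≤j-i p²≤5K²) (four-M a K))
  where
  four-M : ∀ a K → + 5 * (K * K) - (+ 2 * (- a) + K) * (+ 2 * (- a) + K)
    ≡ + 4 * (K * K + a * K - a * a)
  four-M = solve-∀

-- Kφ ≤ a + 1 with K > 0 gives a ≥ 0 and M (1 + a) K ≤ 0: here w = 2(a + 1) - K ≥ 0,
-- so 2a + 1 = w + (K - 1) ≥ 0, and 5K² ≤ w², where w² - 5K² = -4 M (1 + a) K.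
above-Kφ : ∀ {a K} → 0ℤ < K → (ι K ⊗ φ) ≤φ ι (a + + 1) → 0ℤ ≤ a × M (+ 1 + a) K ≤ 0ℤ
above-Kφ {a} {K} 0<K Kφ≤a+1
  with NonNeg-im<0 {x = a + + 1} (neg-mono-< 0<K) (subst NonNeg (minus-Kφ K a) Kφ≤a+1)
... | 0≤w , 5K²≤w² =
  0≤2x+1⇒0≤x (0≤-≡ (0≤-+ 0≤w (gap 0<K)) (odd-via-w a K)) ,
  0≤i-j⇒j≤i (0≤4*⇒0≤ (0≤-≡ (i≤j⇒0≤j-i 5K²≤w²) (four-M-succ a K)))
  where
  odd-via-w : ∀ a K → + 2 * (a + + 1) + - K + (K - (+ 1 + 0ℤ)) ≡ + 2 * a + + 1
  odd-via-w = solve-∀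
  four-M-succ : ∀ a K → (+ 2 * (a + + 1) + - K) * (+ 2 * (a + + 1) + - K) - + 5 * (- K * - K)
    ≡ + 4 * (0ℤ - (K * K + (+ 1 + a) * K - (+ 1 + a) * (+ 1 + a)))
  four-M-succ = solve-∀

-- The hypothesis a = ⌊Kφ⌋ of the theorem yields IsFloorφ K a; irrationality makes the
-- two inequalities of below-Kφ and above-Kφ strict.
floor-decode : ∀ {K a} → 0ℤ < K → IsFloor (ι K ⊗ φ) a → IsFloorφ K a
floor-decode {K} {a} 0<K (a≤Kφ , Kφ≤a+1 , _) with above-Kφ 0<K Kφ≤a+1
... | 0≤a , M≤0 = floorφ 0≤a
  (≤∧≢⇒< (below-Kφ 0≤a 0<K a≤Kφ) (M-nonzero 0<K 0≤a ∘ sym))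
  (≤∧≢⇒< M≤0 (M-nonzero 0<K (0≤-+ (0≤+ 1) 0≤a)))

-- Kφ < 2K: if 2K ≤ a then with t = a - 2K we get -M a K = K² + 3Kt + t² ≥ 0.
below-2K : ∀ {a K} → 0ℤ < K → 0ℤ < M a K → a < + 2 * K
below-2K {a} {K} 0<K 0<M with + 2 * K ≤? a
... | no 2K≰a  = ≰⇒> 2K≰a
... | yes 2K≤a = ⊥-elim (<⇒≱ 0<M (0≤i-j⇒j≤i {0ℤ} (0≤-≡ -M≥0 (negM-via-t a K))))
  where
  -M≥0 = 0≤-+ (0≤-+ (0≤-sq K) (0≤-* (0≤-* (0≤+ 3) (<⇒≤ 0<K)) (i≤j⇒0≤j-i 2K≤a)))
              (0≤-sq (a - + 2 * K))
  negM-via-t : ∀ a K → K * K + + 3 * K * (a - + 2 * K) + (a - + 2 * K) * (a - + 2 * K)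
    ≡ 0ℤ - (K * K + a * K - a * a)
  negM-via-t = solve-∀

-- For a = ⌊Kφ⌋, M a K = M (1 + a) K + (2a + 1 - K) < 2a + 1 - K ≤ a + K.
M-below-a+K : ∀ {a K} → 0ℤ < K → IsFloorφ K a → M a K < a + K
M-below-a+K {a} {K} 0<K (floorφ _ 0<M 1+a-above) =
  gap⁻¹ (0≤-≡ (0≤-+ (gap 1+a-above) (gap (below-2K {a} 0<K 0<M))) (M-shift a K))
  where
  M-shift : ∀ a K → let M₀ = K * K + a * K - a * a
                        M₁ = K * K + (+ 1 + a) * K - (+ 1 + a) * (+ 1 + a)
                    in (0ℤ - (+ 1 + M₁)) + (+ 2 * K - (+ 1 + a)) ≡ a + K - (+ 1 + M₀)
  M-shift = solve-∀

-- The heart of the theorem: if a = ⌊Kφ⌋ then c = 4a + 3K - 1 is the integer part of Dφ,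
-- D = 3a + K, because M c D = 5 (a + K - M a K) - 1 > 0 and M (1 + c) D = -5 M a K < 0.
floor-of-3a+K : ∀ {a K} → 0ℤ < K → IsFloorφ K a →
  IsFloorφ (+ 3 * a + K) (+ 4 * a + + 3 * K - + 1)
floor-of-3a+K {a} {K} 0<K fa@(floorφ 0≤a 0<M _) = floorφ
  (0≤-≡ (0≤-+ (0≤-+ (0≤-* (0≤+ 4) 0≤a) (0≤-* (0≤+ 3) (gap 0<K))) (0≤+ 2)) (c-nonneg a K))
  (gap⁻¹ (0≤-≡ (0≤-+ (0≤-* (0≤+ 5) (gap (M-below-a+K 0<K fa))) (0≤+ 3)) (c-below a K)))
  (gap⁻¹ (0≤-≡ (0≤-+ (0≤-* (0≤+ 5) (gap 0<M)) (0≤+ 4)) (1+c-above a K)))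
  where
  c-nonneg : ∀ a K → + 4 * a + + 3 * (K - (+ 1 + 0ℤ)) + + 2 ≡ + 4 * a + + 3 * K - + 1
  c-nonneg = solve-∀
  c-below : ∀ a K → let c = + 4 * a + + 3 * K - + 1; D = + 3 * a + K in
    + 5 * (a + K - (+ 1 + (K * K + a * K - a * a))) + + 3
      ≡ (D * D + c * D - c * c) - (+ 1 + 0ℤ)
  c-below = solve-∀
  1+c-above : ∀ a K → let c = + 4 * a + + 3 * K - + 1; D = + 3 * a + K in
    + 5 * ((K * K + a * K - a * a) - (+ 1 + 0ℤ)) + + 4
      ≡ 0ℤ - (+ 1 + (D * D + (+ 1 + c) * D - (+ 1 + c) * (+ 1 + c)))
  1+c-above = solve-∀

-- With c = 4a + 3K - 1:  (3a + K)φ - c = 1 - (√5/φ²)(Kφ - a), as √5/φ² = 3φ - 4.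
frac-identity : ∀ a K → frac (ι (+ 3 * a + K) ⊗ φ) (+ 4 * a + + 3 * K - + 1)
  ≡ ι (+ 1) ⊖ (√5 ⊗ φ⁻¹ ⊗ φ⁻¹) ⊗ frac (ι K ⊗ φ) a
frac-identity a K = cong₂ mk (re-eq a K) (im-eq a K)
  where
  -- the coordinates as the operations of Defs compute them, √5 ⊗ φ⁻¹ ⊗ φ⁻¹ being mk (-4) 3
  re-eq : ∀ a K → let xr = K * + 0 + + 0 * + 1 + - a
                      xi = K * + 1 + + 0 * + 0 + + 0 * + 1 + - (+ 0)
                  in (+ 3 * a + K) * + 0 + + 0 * + 1 + - (+ 4 * a + + 3 * K - + 1)
                       ≡ + 1 + - (- (+ 4) * xr + + 3 * xi)
  re-eq = solve-∀
  im-eq : ∀ a K → let xr = K * + 0 + + 0 * + 1 + - a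
                      xi = K * + 1 + + 0 * + 0 + + 0 * + 1 + - (+ 0)
                  in (+ 3 * a + K) * + 1 + + 0 * + 0 + + 0 * + 1 + - (+ 0)
                       ≡ + 0 + - (- (+ 4) * xi + + 3 * xr + + 3 * xi)
  im-eq = solve-∀

theorem4p3 : (k : ℕ) → (+ 0) < (+ k) → (a b : ℤ) →
    IsFloor (ι (+ k) ⊗ φ) a →
    IsFloor (ι ((+ 3) * a + (+ k)) ⊗ φ) b →
    frac (ι ((+ 3) * a + (+ k)) ⊗ φ) b
      ≡ ι (+ 1) ⊖ (√5 ⊗ φ⁻¹ ⊗ φ⁻¹) ⊗ frac (ι (+ k) ⊗ φ) a
theorem4p3 k 0<k a b a-floor b-floor = begin
  frac (ι D ⊗ φ) b                                    ≡⟨ cong (frac (ι D ⊗ φ)) b≡c ⟩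
  frac (ι D ⊗ φ) c                                    ≡⟨ frac-identity a (+ k) ⟩
  ι (+ 1) ⊖ (√5 ⊗ φ⁻¹ ⊗ φ⁻¹) ⊗ frac (ι (+ k) ⊗ φ) a  ∎
  where
  open ≡-Reasoning
  D = + 3 * a + + k
  c = + 4 * a + + 3 * + k - + 1
  a-floorφ : IsFloorφ (+ k) a
  a-floorφ = floor-decode 0<k a-floor
  -- D = 3a + (k - 1) + 1 with a ≥ 0
  0<D : 0ℤ < D
  0<D = gap⁻¹ (0≤-≡ (0≤-+ (0≤-* (0≤+ 3) (IsFloorφ.nonneg a-floorφ)) (gap 0<k)) (D-gap a (+ k)))
    where
    D-gap : ∀ a K → + 3 * a + (K - (+ 1 + 0ℤ)) ≡ + 3 * a + K - (+ 1 + 0ℤ)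
    D-gap = solve-∀
  b≡c : b ≡ c
  b≡c = floor-unique (floor-decode 0<D b-floor) (floor-of-3a+K 0<k a-floorφ)
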